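{- Let $\mathcal{C}$ be a trim binary Boolean VCSP instance. If the binary Boolean VCSP instance $\mathcal{C}'$ is sign-equivalent to $\mathcal{C}$, then $E(\mathcal{C})\subseteq E(\mathcal{C}')$.
   Context: Variables are indexed by $[n]$, each with domain $\{0,1\}$; points are $x\in\{0,1\}^n$; $x[i\mapsto b]$ is $x$ with coordinate $i$ set to $b$, and $\bar b=1-b$. A (valued) constraint with scope $S\subseteq[n]$ is a function $C_S:\{0,1\}^S\to\mathbb{Z}$. A binary Boolean VCSP instance is a finite set of constraints with scopes of size at most $2$, at most one per scope; it implements $f(x)=\sum_{C_S\in\mathcal{C}}C_S(x[S])$. Its fitness graph $G_\mathcal{C}$ has vertex set $\{0,1\}^n$ and a directed edge $(x,y)$ iff $x,y$ differ in exactly one coordinate and $f(y)>f(x)$. Two instances are sign-equivalent if they have the same fitness graph. The constraint graph has vertex set $[n]$ and edge set $E(\mathcal{C})$ of those $\{i,j\}$ for which $\mathcal{C}$ has a binary constraint with scope $\{i,j\}$ that is not identically zero. An instance is simple if every unary constraint satisfies $C_i(0)=0,C_i(1)=c_i$ and every binary constraint satisfies $C_{ij}(0,0)=C_{ij}(0,1)=C_{ij}(1,0)=0$, $C_{ij}(1,1)=c_{ij}$ (a constant constraint is allowed). In a fitness graph $G$, $i$ sign-depends on $j$ if there is $x$ with $(x,x[i\mapsto\bar x_i])\in E(G)$ but $(x[j\mapsto \bar x_j],x[i\mapsto\bar x_i,j\mapsto\bar x_j])\notin E(G)$; $i$ and $j$ sign-interact if $i$ sign-depends on $j$ or $j$ sign-depends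 on $i$. A simple binary Boolean instance $\mathcal{C}$ is trim if for every $\{i,j\}\in E(\mathcal{C})$, $i$ and $j$ sign-interact in $G_\mathcal{C}$. -}

module Defs where

open import Data.Nat using (ℕ; zero; suc)
open import Data.Fin using (Fin; toℕ; _≟_)
import Data.Fin as F
open import Data.Bool using (Bool; true; false; not; if_then_else_)
open import Data.Integer using (ℤ; _+_; _<_; 0ℤ)
open import Data.Product using (Σ; ∃; _×_; _,_)
open import Relation.Nullary using (¬_; yes; no)
open import Relation.Nullary.Decidable using (⌊_⌋)
open import Relation.Binary.PropositionalEquality using (_≡_; _≢_)
open import Data.Sum using (_⊎_)
import Data.Nat as N

-- Points of {0,1}^n (0 = false, 1 = true)
Point : ℕ → Set
Point n = Fin n → Bool

sumFin : (n : ℕ) → (Fin n → ℤ) → ℤ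
sumFin zero    g = 0ℤ
sumFin (suc n) g = g F.zero + sumFin n (λ k → g (F.suc k))

-- A binary Boolean VCSP instance on n variables:
--  * a constraint with empty scope (a constant),
--  * one unary constraint per variable (absent constraints = identically 0),
--  * one binary constraint per scope {i,j}, stored at (i , j) with toℕ i < toℕ j,
--    read as  bin i j (x i) (x j)  (entries with toℕ i ≥ toℕ j are ignored).
record Instance (n : ℕ) : Set where
  field
    const : ℤ
    unary : Fin n → Bool → ℤ
    bin   : Fin n → Fin n → Bool → Bool → ℤ
open Instance public

pairSum : (n : ℕ) → (Fin n → Fin n → ℤ) → ℤ
pairSum n g = sumFin n (λ i → sumFin n (λ j → if ⌊ toℕ i N.<? toℕ j ⌋ then g i j else 0ℤ))

eval : ∀ {n} → Instance n → Point n → ℤ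
eval {n} C x = const C + sumFin n (λ i → unary C i (x i))
                       + pairSum n (λ i j → bin C i j (x i) (x j))

flipAt : ∀ {n} → Point n → Fin n → Point n
flipAt x i k = if ⌊ k ≟ i ⌋ then not (x k) else x k

Edge : ∀ {n} → Instance n → Point n → Point n → Set
Edge {n} C x y =
  (Σ (Fin n) λ i → (x i ≢ y i) × (∀ k → k ≢ i → x k ≡ y k))
  × (eval C x < eval C y)

SignEquivalent : ∀ {n} → Instance n → Instance n → Set
SignEquivalent {n} C D = ∀ (x y : Point n) → (Edge C x y → Edge D x y) × (Edge D x y → Edge C x y)

NonZeroBin : ∀ {n} → Instance n → Fin n → Fin n → Set
NonZeroBin C i j = Σ Bool λ a → Σ Bool λ b → bin C i j a b ≢ 0ℤ

InE : ∀ {n} → Instance n → Fin n → Fin n → Set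
InE C i j = (toℕ i N.< toℕ j) × NonZeroBin C i j

EdgeSubset : ∀ {n} → Instance n → Instance n → Set
EdgeSubset {n} C D = ∀ (i j : Fin n) → InE C i j → InE D i j

Simple : ∀ {n} → Instance n → Set
Simple {n} C =
  (∀ (i : Fin n) → unary C i false ≡ 0ℤ)
  × (∀ (i j : Fin n) → toℕ i N.< toℕ j →
       (bin C i j false false ≡ 0ℤ) × (bin C i j false true ≡ 0ℤ) × (bin C i j true false ≡ 0ℤ))

SignDepends : ∀ {n} → Instance n → Fin n → Fin n → Set
SignDepends {n} C i j =
  Σ (Point n) λ x → Edge C x (flipAt x i)
                   × ¬ Edge C (flipAt x j) (flipAt (flipAt x j) i)

SignInteract : ∀ {n} → Instance n → Fin n → Fin n → Set
SignInteract C i j = SignDepends C i j ⊎ SignDepends C j i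

Trim : ∀ {n} → Instance n → Set
Trim {n} C = Simple C × (∀ (i j : Fin n) → InE C i j → SignInteract C i j)

-- If the binary constraint on {p, q} vanishes, then f(x) + f(x[p,q flipped]) = f(x[p flipped]) +
-- f(x[q flipped]) for every x: each remaining term of f reads only coordinates that are unchanged
-- along the p-edges of this square, or only coordinates unchanged along its q-edges.  Hence the sign
-- of the p-edge at x agrees with that at x[q flipped], i.e. p does not sign-depend on q.  So sign
-- interaction forces a binary constraint on {p, q}, and sign interaction is a property of the fitness
-- graph alone.
module Submission where

open import Data.Nat using (ℕ)
open import Defs

open import Data.Bool using (Bool; true; false; not; if_then_else_)
open import Data.Bool.Properties using (not-¬)
open import Data.Empty using (⊥-elim)
open import Data.Fin using (Fin; toℕ; _≟_)
import Data.Fin as Fin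
open import Data.Fin.Properties using (toℕ-injective)
open import Data.Integer using (ℤ; _+_; _<_; 0ℤ)
open import Data.Integer.Properties
  using (+-comm; +-commutativeSemigroup; _<?_; <-irrefl; ≤-<-trans; +-monoʳ-≤; +-monoˡ-<; ≮⇒≥)
import Data.Integer.Properties as ℤ
import Data.Nat as ℕ
import Data.Nat.Properties as ℕ
open import Data.Product using (Σ; _×_; _,_; proj₁; proj₂)
open import Data.Sum using (_⊎_; inj₁; inj₂; [_,_]; map; swap; fromInj₁)
open import Function using (_∘_; case_of_)
open import Relation.Binary.Definitions using (tri<; tri≈; tri>)
open import Relation.Binary.PropositionalEquality
  using (_≡_; _≢_; refl; sym; trans; cong₂; module ≡-Reasoning)
open import Relation.Nullary using (¬_; yes; no)
open import Relation.Nullary.Decidable using (⌊_⌋; decidable-stable)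
open import Algebra.Properties.CommutativeSemigroup +-commutativeSemigroup using (interchange)

balanced-< : ∀ {a b c d : ℤ} → a + d ≡ b + c → a < b → c < d
balanced-< {a} {b} {c} {d} eq a<b = decidable-stable (c <? d) λ c≮d →
  <-irrefl eq (≤-<-trans (+-monoʳ-≤ a (≮⇒≥ c≮d)) (+-monoˡ-< c a<b))

Vanishes : ∀ {n} → Instance n → Fin n → Fin n → Set
Vanishes D k l = ∀ u v → bin D k l u v ≡ 0ℤ

nonZeroBin-or-vanishes : ∀ {n} (D : Instance n) k l → NonZeroBin D k l ⊎ Vanishes D k l
nonZeroBin-or-vanishes D k l
  with bin D k l false false ℤ.≟ 0ℤ | bin D k l false true ℤ.≟ 0ℤ
     | bin D k l true false ℤ.≟ 0ℤ  | bin D k l true true ℤ.≟ 0ℤ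
... | no ≢0 | _     | _     | _     = inj₁ (false , false , ≢0)
... | _     | no ≢0 | _     | _     = inj₁ (false , true , ≢0)
... | _     | _     | no ≢0 | _     = inj₁ (true , false , ≢0)
... | _     | _     | _     | no ≢0 = inj₁ (true , true , ≢0)
... | yes ff | yes ft | yes tf | yes tt = inj₂ λ where
  false false → ff
  false true  → ft
  true  false → tf
  true  true  → tt

module Square {n : ℕ} (a b c d : Point n) where

  record Balanced (h : Point n → ℤ) : Set where
    constructor balanced
    field square : h a + h d ≡ h b + h c

  Fixed₁ Fixed₂ : Fin n → Set
  Fixed₁ k = a k ≡ b k × c k ≡ d k
  Fixed₂ k = a k ≡ c k × b k ≡ d k

  balanced-+ : ∀ {g h} → Balanced g → Balanced h → Balanced (λ p → g p + h p)
  balanced-+ {g} {h} (balanced bg) (balanced bh) = balanced (begin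
    (g a + h a) + (g d + h d) ≡⟨ interchange (g a) (h a) (g d) (h d) ⟩
    (g a + g d) + (h a + h d) ≡⟨ cong₂ _+_ bg bh ⟩
    (g b + g c) + (h b + h c) ≡⟨ interchange (g b) (g c) (h b) (h c) ⟩
    (g b + h b) + (g c + h c) ∎)
    where open ≡-Reasoning

  balanced-const : ∀ z → Balanced (λ _ → z)
  balanced-const z = balanced refl

  balanced-sumFin : ∀ m {h : Fin m → Point n → ℤ} →
    (∀ k → Balanced (h k)) → Balanced (λ p → sumFin m (λ k → h k p))
  balanced-sumFin ℕ.zero    bh = balanced refl
  balanced-sumFin (ℕ.suc m) bh = balanced-+ (bh Fin.zero) (balanced-sumFin m (bh ∘ Fin.suc))

  balanced-binary : ∀ k l (w : Bool → Bool → ℤ) →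
    (Fixed₁ k × Fixed₁ l) ⊎ (Fixed₂ k × Fixed₂ l) → Balanced (λ p → w (p k) (p l))
  balanced-binary k l w (inj₁ ((ab , cd) , (ab′ , cd′))) =
    balanced (cong₂ _+_ (cong₂ w ab ab′) (sym (cong₂ w cd cd′)))
  balanced-binary k l w (inj₂ ((ac , bd) , (ac′ , bd′))) =
    balanced (trans (cong₂ _+_ (cong₂ w ac ac′) (sym (cong₂ w bd bd′)))
                    (+-comm (w (c k) (c l)) (w (b k) (b l))))

  balanced-unary : ∀ k (u : Bool → ℤ) → Fixed₁ k ⊎ Fixed₂ k → Balanced (λ p → u (p k))
  balanced-unary k u = balanced-binary k k (λ v _ → u v) ∘ map (λ f → f , f) (λ f → f , f)

  balanced-vanishing : ∀ {h} → (∀ p → h p ≡ 0ℤ) → Balanced h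
  balanced-vanishing h≡0 =
    balanced (trans (cong₂ _+_ (h≡0 a) (h≡0 d)) (sym (cong₂ _+_ (h≡0 b) (h≡0 c))))

  balanced-eval : (D : Instance n) →
    (∀ k → Fixed₁ k ⊎ Fixed₂ k) →
    (∀ k l → toℕ k ℕ.< toℕ l → ((Fixed₁ k × Fixed₁ l) ⊎ (Fixed₂ k × Fixed₂ l)) ⊎ Vanishes D k l) →
    Balanced (eval D)
  balanced-eval D unaryOk binaryOk =
    balanced-+ (balanced-+ (balanced-const (const D))
                           (balanced-sumFin n λ k → balanced-unary k (unary D k) (unaryOk k)))
               (balanced-sumFin n λ k → balanced-sumFin n (pairTerm-balanced k))
    where
    pairTerm : Fin n → Point n → Fin n → ℤ
    pairTerm k p l = if ⌊ toℕ k ℕ.<? toℕ l ⌋ then bin D k l (p k) (p l) else 0ℤ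

    pairTerm-balanced : ∀ k l → Balanced (λ p → pairTerm k p l)
    pairTerm-balanced k l with toℕ k ℕ.<? toℕ l
    ... | no _ = balanced refl
    ... | yes k<l with binaryOk k l k<l
    ...   | inj₁ fixed = balanced-binary k l (bin D k l) fixed
    ...   | inj₂ zero  = balanced-vanishing λ p → zero (p k) (p l)

flipAt-self : ∀ {n} (x : Point n) i → flipAt x i i ≡ not (x i)
flipAt-self x i with i ≟ i
... | yes _   = refl
... | no  i≢i = ⊥-elim (i≢i refl)

flipAt-other : ∀ {n} (x : Point n) {i k} → k ≢ i → flipAt x i k ≡ x k
flipAt-other x {i} {k} k≢i with k ≟ i
... | yes k≡i = ⊥-elim (k≢i k≡i)
... | no  _   = refl

flipAt-comm : ∀ {n} (x : Point n) i j k → flipAt (flipAt x j) i k ≡ flipAt (flipAt x i) j k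
flipAt-comm x i j k with k ≟ i | k ≟ j
... | yes _ | yes _ = refl
... | yes _ | no  _ = refl
... | no  _ | yes _ = refl
... | no  _ | no  _ = refl

flipAt-adjacent : ∀ {n} (x : Point n) i →
  Σ (Fin n) λ i′ → (x i′ ≢ flipAt x i i′) × (∀ k → k ≢ i′ → x k ≡ flipAt x i k)
flipAt-adjacent x i =
  i , (λ eq → not-¬ refl (trans eq (flipAt-self x i))) , λ k k≢i → sym (flipAt-other x k≢i)

pair-cases : ∀ {n} {p q : Fin n} → p ≢ q → ∀ k l →
  (k ≢ p × l ≢ p) ⊎ (k ≢ q × l ≢ q) ⊎ (k ≡ p × l ≡ q) ⊎ (k ≡ q × l ≡ p)
pair-cases {p = p} {q} p≢q k l with k ≟ p | l ≟ p | k ≟ q | l ≟ q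
... | no k≢p   | no l≢p   | _        | _        = inj₁ (k≢p , l≢p)
... | _        | _        | no k≢q   | no l≢q   = inj₂ (inj₁ (k≢q , l≢q))
... | yes k≡p  | _        | _        | yes l≡q  = inj₂ (inj₂ (inj₁ (k≡p , l≡q)))
... | _        | yes l≡p  | yes k≡q  | _        = inj₂ (inj₂ (inj₂ (k≡q , l≡p)))
... | yes refl | _        | yes refl | _        = ⊥-elim (p≢q refl)
... | _        | yes refl | _        | yes refl = ⊥-elim (p≢q refl)

BinaryFree : ∀ {n} → Instance n → Fin n → Fin n → Set
BinaryFree D p q = ∀ k l → toℕ k ℕ.< toℕ l → (k ≡ p × l ≡ q) ⊎ (k ≡ q × l ≡ p) → Vanishes D k l

Linked : ∀ {n} → Instance n → Fin n → Fin n → Set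
Linked D p q = InE D p q ⊎ InE D q p

module _ {n : ℕ} (D : Instance n) where

  vanishes⇒binaryFree : ∀ {p q} → toℕ p ℕ.< toℕ q → Vanishes D p q → BinaryFree D p q
  vanishes⇒binaryFree p<q zero k l k<l (inj₁ (refl , refl)) = zero
  vanishes⇒binaryFree p<q zero k l k<l (inj₂ (refl , refl)) = ⊥-elim (ℕ.<-asym p<q k<l)

  binaryFree-sym : ∀ {p q} → BinaryFree D p q → BinaryFree D q p
  binaryFree-sym free k l k<l = free k l k<l ∘ swap

  module _ {p q : Fin n} (p≢q : p ≢ q) where

    binaryFree⇒¬signDepends : BinaryFree D p q → ¬ SignDepends D p q
    binaryFree⇒¬signDepends free (x , (_ , fa<fb) , ¬edge) =
      ¬edge (flipAt-adjacent c p , balanced-< (Balanced.square square) fa<fb)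
      where
      a b c d : Point n
      a = x
      b = flipAt x p
      c = flipAt x q
      d = flipAt c p

      open Square a b c d

      fixed₁ : ∀ {k} → k ≢ p → Fixed₁ k
      fixed₁ k≢p = sym (flipAt-other a k≢p) , sym (flipAt-other c k≢p)

      fixed₂ : ∀ {k} → k ≢ q → Fixed₂ k
      fixed₂ {k} k≢q =
        sym (flipAt-other a k≢q) , trans (sym (flipAt-other b k≢q)) (flipAt-comm x q p k)

      square : Balanced (eval D)
      square = balanced-eval D coordinate pair
        where
        coordinate : ∀ k → Fixed₁ k ⊎ Fixed₂ k
        coordinate k = case k ≟ p of λ where
          (yes refl) → inj₂ (fixed₂ p≢q)
          (no  k≢p)  → inj₁ (fixed₁ k≢p)

        pair : ∀ k l → toℕ k ℕ.< toℕ l →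
          ((Fixed₁ k × Fixed₁ l) ⊎ (Fixed₂ k × Fixed₂ l)) ⊎ Vanishes D k l
        pair k l k<l with pair-cases p≢q k l
        ... | inj₁ (k≢p , l≢p)        = inj₁ (inj₁ (fixed₁ k≢p , fixed₁ l≢p))
        ... | inj₂ (inj₁ (k≢q , l≢q)) = inj₁ (inj₂ (fixed₂ k≢q , fixed₂ l≢q))
        ... | inj₂ (inj₂ onPair)      = inj₂ (free k l k<l onPair)

    linked-or-binaryFree : Linked D p q ⊎ BinaryFree D p q
    linked-or-binaryFree with ℕ.<-cmp (toℕ p) (toℕ q)
    ... | tri< p<q _ _ =
      map (inj₁ ∘ (p<q ,_)) (vanishes⇒binaryFree p<q) (nonZeroBin-or-vanishes D p q)
    ... | tri≈ _ p≡q _ = ⊥-elim (p≢q (toℕ-injective p≡q))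
    ... | tri> _ _ q<p =
      map (inj₂ ∘ (q<p ,_)) (binaryFree-sym ∘ vanishes⇒binaryFree q<p) (nonZeroBin-or-vanishes D q p)

    signDepends⇒linked : SignDepends D p q → Linked D p q
    signDepends⇒linked dep =
      fromInj₁ (λ free → ⊥-elim (binaryFree⇒¬signDepends free dep)) linked-or-binaryFree

  signInteract⇒linked : ∀ {p q} → p ≢ q → SignInteract D p q → Linked D p q
  signInteract⇒linked p≢q = [ signDepends⇒linked p≢q , swap ∘ signDepends⇒linked (p≢q ∘ sym) ]

module _ {n : ℕ} (C D : Instance n) (C≈D : SignEquivalent C D) where

  signDepends-transport : ∀ {i j} → SignDepends C i j → SignDepends D i j
  signDepends-transport (x , edge , ¬edge) =
    x , proj₁ (C≈D _ _) edge , ¬edge ∘ proj₂ (C≈D _ _)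

  signInteract-transport : ∀ {i j} → SignInteract C i j → SignInteract D i j
  signInteract-transport = map signDepends-transport signDepends-transport

theorem4 : ∀ (n : ℕ) (C C' : Instance n) → Trim C → SignEquivalent C C' → EdgeSubset C C'
theorem4 n C C' (_ , interacts) C≈C' i j ij∈E@(i<j , _) =
  fromInj₁ (λ ji∈E′ → ⊥-elim (ℕ.<-asym i<j (proj₁ ji∈E′)))
           (signInteract⇒linked C' i≢j (signInteract-transport C C' C≈C' (interacts i j ij∈E)))
  where
  i≢j : i ≢ j
  i≢j refl = ℕ.<-irrefl refl i<j
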